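{- Let $G$ be a strongly connected weighted directed graph on vertex set $V$ of size $n$ with edge weights in $[1,U]$. For every $\ell\in\mathbb{N}$ and $S,T\subseteq V$ with $\mathrm{vol}(S)+\mathrm{vol}(T)\ge1$, either $\mathrm{Cut}_{G^\ell}(S,T)=0$ or $\mathrm{Cut}_{G^\ell}(S,T)\ge(\pi_{\min}/2U)^3$.
   Context: For a weighted digraph with adjacency $A$ ($A_{j,i}$ = weight of edge $i\to j$) and diagonal out-degree matrix $D_{\mathrm{out}}$, $W=AD_{\mathrm{out}}^{ -1}$; $\pi$ is the unique stationary distribution of $G$ ($W\pi=\pi$, $\sum_v\pi_v=1$), $\pi_{\min}=\min_v\pi_v$, $\mathrm{vol}(S)=\sum_{v\in S}\pi_v$. $G^\ell$ is the digraph with adjacency $(AD_{\mathrm{out}}^{ -1})^\ell D_{\mathrm{out}}$. $\mathrm{Cut}_H(S,T)=\Pr_{(i,j)\sim\mu_{\mathrm{edge}}}[i\in S,j\in T]$, where $\mu_{\mathrm{edge}}$ picks $i$ from the stationary distribution of $H$ and $j$ by following an out-edge of $i$ with probability proportional to its weight. -}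

module Defs where

open import Level using (Level; _⊔_) renaming (suc to lsuc)
open import Data.Nat using (ℕ; zero; suc)
open import Data.Fin using (Fin; zero; suc; _≟_)
open import Data.Fin.Subset using (Subset)
open import Data.Vec using (lookup)
open import Data.Bool using (if_then_else_)
open import Data.Product using (Σ; _×_)
open import Data.Sum using (_⊎_)
open import Relation.Nullary using (¬_)
open import Relation.Nullary.Decidable using (⌊_⌋)
open import Relation.Binary using (Rel; IsTotalOrder)
open import Relation.Binary.Construct.Closure.ReflexiveTransitive using (Star)
open import Algebra.Bundles using (CommutativeRing)

-- An ordered field (commutative ring + total inverse on nonzero elements
-- + compatible total order).  ℝ is an instance; the theorem is stated
-- for every ordered field.
record OrderedField (c ℓ₁ ℓ₂ : Level) : Set (lsuc (c ⊔ ℓ₁ ⊔ ℓ₂)) where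
  field
    commutativeRing : CommutativeRing c ℓ₁
  open CommutativeRing commutativeRing public
  field
    _⁻¹        : Carrier → Carrier
    0≉1        : ¬ (0# ≈ 1#)
    ⁻¹-inverse : ∀ x → ¬ (x ≈ 0#) → (x * (x ⁻¹)) ≈ 1#
    _≤_        : Rel Carrier ℓ₂
    ≤-isTotalOrder : IsTotalOrder _≈_ _≤_
    +-monoˡ-≤  : ∀ {x y} z → x ≤ y → (x + z) ≤ (y + z)
    *-nonneg   : ∀ {x y} → 0# ≤ x → 0# ≤ y → 0# ≤ (x * y)

module _ {c ℓ₁ ℓ₂} (F : OrderedField c ℓ₁ ℓ₂) where
  open OrderedField F using (Carrier; _≈_; _≤_; _+_; _*_; 0#; 1#; _⁻¹)

  Mat : ℕ → Set c
  Mat n = Fin n → Fin n → Carrier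

  ∑ : ∀ {n} → (Fin n → Carrier) → Carrier
  ∑ {zero}  f = 0#
  ∑ {suc n} f = f zero + ∑ (λ i → f (suc i))

  -- out-degree of vertex i: sum of weights of edges i → j, i.e. ∑_j A j i
  outDeg : ∀ {n} → Mat n → Fin n → Carrier
  outDeg A i = ∑ (λ j → A j i)

  walkMat : ∀ {n} → Mat n → Mat n
  walkMat A j i = A j i * (outDeg A i ⁻¹)

  idMat : ∀ {n} → Mat n
  idMat j i = if ⌊ j ≟ i ⌋ then 1# else 0#

  _·_ : ∀ {n} → Mat n → Mat n → Mat n
  (M · N) j i = ∑ (λ k → M j k * N k i)

  matPow : ∀ {n} → Mat n → ℕ → Mat n
  matPow M zero    = idMat
  matPow M (suc ℓ) = M · matPow M ℓ

  Edge : ∀ {n} → Mat n → Fin n → Fin n → Set ℓ₁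
  Edge A i j = ¬ (A j i ≈ 0#)

  StronglyConnected : ∀ {n} → Mat n → Set ℓ₁
  StronglyConnected A = ∀ i j → Star (Edge A) i j

  WeightsIn1U : ∀ {n} → Mat n → Carrier → Set (ℓ₁ ⊔ ℓ₂)
  WeightsIn1U A U = ∀ i j → (A j i ≈ 0#) ⊎ ((1# ≤ A j i) × (A j i ≤ U))

  Stationary : ∀ {n} → Mat n → (Fin n → Carrier) → Set (ℓ₁ ⊔ ℓ₂)
  Stationary A π =
    (∀ j → ∑ (λ i → walkMat A j i * π i) ≈ π j)
    × (∀ v → 0# ≤ π v)
    × (∑ π ≈ 1#)

  IsMin : ∀ {n} → (Fin n → Carrier) → Carrier → Set (ℓ₁ ⊔ ℓ₂)
  IsMin π m = Σ _ (λ v → π v ≈ m) × (∀ v → m ≤ π v)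

  indic : ∀ {n} → Subset n → Fin n → Carrier → Carrier
  indic S i x = if lookup S i then x else 0#

  vol : ∀ {n} → (Fin n → Carrier) → Subset n → Carrier
  vol π S = ∑ (λ v → indic S v (π v))

  -- Cut_{G^ℓ}(S,T) = Pr[i ∈ S, j ∈ T], i ~ π, j ~ (W^ℓ)_{·,i}
  cutPow : ∀ {n} → Mat n → (Fin n → Carrier) → ℕ → Subset n → Subset n → Carrier
  cutPow A π ℓ S T =
    ∑ (λ i → ∑ (λ j → indic S i (indic T j (π i * matPow (walkMat A) ℓ j i))))

  cube : Carrier → Carrier
  cube x = x * x * x

module Submission where

-- Write Cut_{ℓ+1}(S,T) as the sum over k of Pr[start in S, at k after ℓ steps]
-- times Pr[one step from k enters T].  If some vertex k has out-edges both into T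
-- and out of T, each of the two crossing probabilities at k is at least 1/d_k;
-- since vol S + vol T ≥ 1, inclusion–exclusion gives Cut(S,T) ≥ Cut(∁S,∁T), so
-- 2 Cut(S,T) ≥ π_k/d_k ≥ π_min²/U ≥ 2(π_min/2U)³.  Otherwise every vertex sends
-- all or none of its weight into T, so Cut_{ℓ+1}(S,T) = Cut_ℓ(S,T′) for the set
-- T′ of predecessors of T, which has the same volume as T.  Descending to ℓ = 0,
-- Cut_0(S,T) = vol(S ∩ T) is either 0 or at least π_min.

open import Defs
open import Data.Nat using (ℕ; zero; suc)
open import Data.Fin using (Fin; zero; suc; _≟_)
open import Data.Fin.Subset using (Subset; ∁)
open import Data.Sum as Sum using (_⊎_; inj₁; inj₂; [_,_]′)
open import Data.Product using (Σ; _×_; _,_; proj₁; proj₂)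
open import Data.Empty using (⊥-elim)
open import Data.Bool using (true; false; not; if_then_else_)
open import Data.Vec using (lookup; tabulate)
open import Data.Vec.Properties using (lookup∘tabulate; lookup-map)
open import Function using (_∘_)
open import Relation.Nullary using (¬_; yes; no)
open import Relation.Binary using (IsTotalOrder; Poset)
import Relation.Binary.Reasoning.PartialOrder
import Relation.Binary.Reasoning.Setoid as ≈-Reasoning
open import Relation.Binary.Construct.Closure.ReflexiveTransitive using (ε; _◅_)
import Relation.Binary.PropositionalEquality as ≡
open ≡ using (_≡_)

∃-or-∀ : ∀ {n a b} {P : Fin n → Set a} {Q : Fin n → Set b} →
  (∀ i → P i ⊎ Q i) → Σ (Fin n) P ⊎ (∀ i → Q i)
∃-or-∀ {zero}  P⊎Q = inj₂ (λ ())
∃-or-∀ {suc n} P⊎Q with P⊎Q zero | ∃-or-∀ (P⊎Q ∘ suc)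
... | inj₁ p | _            = inj₁ (zero , p)
... | inj₂ _ | inj₁ (i , p) = inj₁ (suc i , p)
... | inj₂ q | inj₂ qs      = inj₂ (λ { zero → q ; (suc i) → qs i })

module OrderedFieldProperties {c ℓ₁ ℓ₂} (F : OrderedField c ℓ₁ ℓ₂) where
  open OrderedField F hiding (zero; _≤_)
  open import Algebra.Solver.Ring.NaturalCoefficients.Default commutativeSemiring
  open import Algebra.Properties.Ring ring using (-1*x≈-x; -‿involutive; -‿distribˡ-*)

  infix 4 _≤_
  _≤_ : Carrier → Carrier → Set ℓ₂
  _≤_ = OrderedField._≤_ F

  open IsTotalOrder ≤-isTotalOrder public
    using (total; antisym; isPartialOrder)
    renaming (trans to ≤-trans; refl to ≤-refl; reflexive to ≤-reflexive;
              ≲-respˡ-≈ to ≤-respˡ-≈; ≲-respʳ-≈ to ≤-respʳ-≈)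

  poset : Poset c ℓ₁ ℓ₂
  poset = record { isPartialOrder = isPartialOrder }

  module ≤-Reasoning = Relation.Binary.Reasoning.PartialOrder poset

  ≤-resp-≈ : ∀ {x x′ y y′} → x ≈ x′ → y ≈ y′ → x ≤ y → x′ ≤ y′
  ≤-resp-≈ x≈x′ y≈y′ x≤y = ≤-respʳ-≈ y≈y′ (≤-respˡ-≈ x≈x′ x≤y)

  +-monoʳ-≤ : ∀ z {x y} → x ≤ y → z + x ≤ z + y
  +-monoʳ-≤ z {x} {y} x≤y = ≤-resp-≈ (+-comm x z) (+-comm y z) (+-monoˡ-≤ z x≤y)

  +-mono-≤ : ∀ {x y u v} → x ≤ y → u ≤ v → x + u ≤ y + v
  +-mono-≤ {y = y} {u} x≤y u≤v = ≤-trans (+-monoˡ-≤ u x≤y) (+-monoʳ-≤ y u≤v)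

  +-cancelʳ-≤ : ∀ z {x y} → x + z ≤ y + z → x ≤ y
  +-cancelʳ-≤ z {x} {y} = ≤-resp-≈ (cancel x) (cancel y) ∘ +-monoˡ-≤ (- z)
    where
    cancel : ∀ w → w + z + - z ≈ w
    cancel w = trans (+-assoc w z (- z)) (trans (+-congˡ (-‿inverseʳ z)) (+-identityʳ w))

  x≤y⇒0≤y-x : ∀ {x y} → x ≤ y → 0# ≤ y + - x
  x≤y⇒0≤y-x {x} = ≤-respˡ-≈ (-‿inverseʳ x) ∘ +-monoˡ-≤ (- x)

  -- 1 < 0 would make -1 nonnegative, and then 1 = (-1)(-1) ≥ 0.
  0≤1 : 0# ≤ 1#
  0≤1 with total 0# 1#
  ... | inj₁ 0≤1 = 0≤1
  ... | inj₂ 1≤0 = ≤-respʳ-≈ (-1*-1≈1) (*-nonneg 0≤-1 0≤-1)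
    where
    0≤-1 : 0# ≤ - 1#
    0≤-1 = ≤-resp-≈ (-‿inverseʳ 1#) (+-identityˡ (- 1#)) (+-monoˡ-≤ (- 1#) 1≤0)
    -1*-1≈1 : - 1# * - 1# ≈ 1#
    -1*-1≈1 = trans (-1*x≈-x (- 1#)) (-‿involutive 1#)

  0≤x+y : ∀ {x y} → 0# ≤ x → 0# ≤ y → 0# ≤ x + y
  0≤x+y 0≤x 0≤y = ≤-respˡ-≈ (+-identityʳ 0#) (+-mono-≤ 0≤x 0≤y)

  *-monoʳ-≤ : ∀ {z x y} → 0# ≤ z → x ≤ y → x * z ≤ y * z
  *-monoʳ-≤ {z} {x} {y} 0≤z x≤y =
    ≤-resp-≈ (+-identityˡ (x * z)) split (+-monoˡ-≤ (x * z) (*-nonneg (x≤y⇒0≤y-x x≤y) 0≤z))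
    where
    split : (y + - x) * z + x * z ≈ y * z
    split = begin
      (y + - x) * z + x * z      ≈⟨ +-congʳ (distribʳ z y (- x)) ⟩
      y * z + - x * z + x * z    ≈⟨ +-assoc (y * z) (- x * z) (x * z) ⟩
      y * z + (- x * z + x * z)  ≈⟨ +-congˡ (trans (+-congʳ (sym (-‿distribˡ-* x z))) (-‿inverseˡ (x * z))) ⟩
      y * z + 0#                 ≈⟨ +-identityʳ (y * z) ⟩
      y * z                      ∎
      where open ≈-Reasoning setoid

  *-monoˡ-≤ : ∀ {z x y} → 0# ≤ z → x ≤ y → z * x ≤ z * y
  *-monoˡ-≤ {z} {x} {y} 0≤z x≤y = ≤-resp-≈ (*-comm x z) (*-comm y z) (*-monoʳ-≤ 0≤z x≤y)

  *-mono-≤ : ∀ {x y u v} → 0# ≤ x → x ≤ y → 0# ≤ u → u ≤ v → x * u ≤ y * v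
  *-mono-≤ 0≤x x≤y 0≤u u≤v = ≤-trans (*-monoʳ-≤ 0≤u x≤y) (*-monoˡ-≤ (≤-trans 0≤x x≤y) u≤v)

  x,y≤1⇒x*y≤1 : ∀ {x y} → 0# ≤ x → x ≤ 1# → 0# ≤ y → y ≤ 1# → x * y ≤ 1#
  x,y≤1⇒x*y≤1 0≤x x≤1 0≤y y≤1 = ≤-respʳ-≈ (*-identityʳ 1#) (*-mono-≤ 0≤x x≤1 0≤y y≤1)

  1≰0 : ¬ (1# ≤ 0#)
  1≰0 1≤0 = 0≉1 (antisym 0≤1 1≤0)

  1≤x⇒x≉0 : ∀ {x} → 1# ≤ x → ¬ (x ≈ 0#)
  1≤x⇒x≉0 1≤x x≈0 = 1≰0 (≤-respʳ-≈ x≈0 1≤x)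

  1≤x⇒0≤x⁻¹ : ∀ {x} → 1# ≤ x → 0# ≤ x ⁻¹
  1≤x⇒0≤x⁻¹ {x} 1≤x with total 0# (x ⁻¹)
  ... | inj₁ 0≤x⁻¹ = 0≤x⁻¹
  ... | inj₂ x⁻¹≤0 = ⊥-elim (1≰0 (≤-resp-≈ (⁻¹-inverse x (1≤x⇒x≉0 1≤x)) (zeroʳ x)
                                    (*-monoˡ-≤ (≤-trans 0≤1 1≤x) x⁻¹≤0)))

  1≤x⇒x⁻¹≤1 : ∀ {x} → 1# ≤ x → x ⁻¹ ≤ 1#
  1≤x⇒x⁻¹≤1 {x} 1≤x = ≤-resp-≈ (*-identityʳ (x ⁻¹))
    (trans (*-comm (x ⁻¹) x) (⁻¹-inverse x (1≤x⇒x≉0 1≤x)))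
    (*-monoˡ-≤ (1≤x⇒0≤x⁻¹ 1≤x) 1≤x)

  x*y≤z⇒x≤y⁻¹*z : ∀ {x y z} → 1# ≤ y → x * y ≤ z → x ≤ y ⁻¹ * z
  x*y≤z⇒x≤y⁻¹*z {x} {y} {z} 1≤y xy≤z =
    ≤-resp-≈ cancel (*-comm z (y ⁻¹)) (*-monoʳ-≤ (1≤x⇒0≤x⁻¹ 1≤y) xy≤z)
    where
    cancel : x * y * y ⁻¹ ≈ x
    cancel = trans (*-assoc x y (y ⁻¹)) (trans (*-congˡ (⁻¹-inverse y (1≤x⇒x≉0 1≤y))) (*-identityʳ x))

  x+x≤y+y⇒x≤y : ∀ {x y} → x + x ≤ y + y → x ≤ y
  x+x≤y+y⇒x≤y {x} {y} 2x≤2y with total x y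
  ... | inj₁ x≤y = x≤y
  ... | inj₂ y≤x = +-cancelʳ-≤ y (≤-trans (+-monoʳ-≤ x y≤x) 2x≤2y)

  module _ {p U : Carrier} (0≤p : 0# ≤ p) (p≤1 : p ≤ 1#) (1≤U : 1# ≤ U) where
    private
      2U h x : Carrier
      2U = (1# + 1#) * U
      h  = 2U ⁻¹
      x  = p * h

      1≤2U : 1# ≤ 2U
      1≤2U = begin
        1#      ≤⟨ 1≤U ⟩
        U       ≈⟨ +-identityʳ U ⟨
        U + 0#  ≤⟨ +-monoʳ-≤ U (≤-trans 0≤1 1≤U) ⟩
        U + U   ≈⟨ solve 1 (λ u → u :+ u := (con 1 :+ con 1) :* u) refl U ⟩
        2U      ∎
        where open ≤-Reasoning

      0≤h : 0# ≤ h
      0≤h = 1≤x⇒0≤x⁻¹ 1≤2U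

      h≤1 : h ≤ 1#
      h≤1 = 1≤x⇒x⁻¹≤1 1≤2U

      0≤x : 0# ≤ x
      0≤x = *-nonneg 0≤p 0≤h

      x≤1 : x ≤ 1#
      x≤1 = x,y≤1⇒x*y≤1 0≤p p≤1 0≤h h≤1

      x*x≤1 : x * x ≤ 1#
      x*x≤1 = x,y≤1⇒x*y≤1 0≤x x≤1 0≤x x≤1

      p*[h*y]≤p : ∀ {y} → 0# ≤ y → y ≤ 1# → p * (h * y) ≤ p
      p*[h*y]≤p 0≤y y≤1 = ≤-respʳ-≈ (*-identityʳ p) (*-monoˡ-≤ 0≤p (x,y≤1⇒x*y≤1 0≤h h≤1 0≤y y≤1))

    cube≤ : cube F (p * ((1# + 1#) * U) ⁻¹) ≤ p
    cube≤ = begin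
      x * x * x          ≈⟨ solve 2 (λ p h → (p :* h) :* (p :* h) :* (p :* h) := p :* (h :* ((p :* h) :* (p :* h)))) refl p h ⟩
      p * (h * (x * x))  ≤⟨ p*[h*y]≤p (*-nonneg 0≤x 0≤x) x*x≤1 ⟩
      p                  ∎
      where open ≤-Reasoning

    [cube+cube]*D≤ : ∀ {D} → p * D ≤ U →
      (cube F (p * ((1# + 1#) * U) ⁻¹) + cube F (p * ((1# + 1#) * U) ⁻¹)) * D ≤ p
    [cube+cube]*D≤ {D} pD≤U = begin
      (x * x * x + x * x * x) * D  ≈⟨ regroup₁ ⟩
      coeff * (p * D)              ≤⟨ *-monoˡ-≤ 0≤coeff pD≤U ⟩
      coeff * U                    ≈⟨ regroup₂ ⟩
      x * x * (2U * h)             ≈⟨ *-congˡ (⁻¹-inverse 2U (1≤x⇒x≉0 1≤2U)) ⟩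
      x * x * 1#                   ≈⟨ *-identityʳ (x * x) ⟩
      x * x                        ≈⟨ solve 2 (λ p h → (p :* h) :* (p :* h) := p :* (h :* (p :* h))) refl p h ⟩
      p * (h * x)                  ≤⟨ p*[h*y]≤p 0≤x x≤1 ⟩
      p                            ∎
      where
      open ≤-Reasoning
      coeff : Carrier
      coeff = x * x * h * (1# + 1#)
      0≤coeff : 0# ≤ coeff
      0≤coeff = *-nonneg (*-nonneg (*-nonneg 0≤x 0≤x) 0≤h) (0≤x+y 0≤1 0≤1)
      regroup₁ : (x * x * x + x * x * x) * D ≈ coeff * (p * D)
      regroup₁ = solve 3 (λ p h d → ((p :* h) :* (p :* h) :* (p :* h) :+ (p :* h) :* (p :* h) :* (p :* h)) :* d
                                     := ((p :* h) :* (p :* h) :* h :* (con 1 :+ con 1)) :* (p :* d)) refl p h D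
      regroup₂ : coeff * U ≈ x * x * (2U * h)
      regroup₂ = solve 3 (λ y h u → (y :* y :* h :* (con 1 :+ con 1)) :* u
                                     := (y :* y) :* (((con 1 :+ con 1) :* u) :* h)) refl x h U

module Summation {c ℓ₁ ℓ₂} (F : OrderedField c ℓ₁ ℓ₂) where
  open OrderedField F hiding (zero; _≤_)
  open OrderedFieldProperties F
  open import Algebra.Properties.Semiring.Sum semiring as SemiringSum using (sum)

  ∑≡sum : ∀ {n} (f : Fin n → Carrier) → ∑ F f ≡ sum f
  ∑≡sum {zero}  f = ≡.refl
  ∑≡sum {suc n} f = ≡.cong (f zero +_) (∑≡sum (f ∘ suc))

  ∑-cong : ∀ {n} {f g : Fin n → Carrier} → (∀ i → f i ≈ g i) → ∑ F f ≈ ∑ F g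
  ∑-cong {f = f} {g} f≈g rewrite ∑≡sum f | ∑≡sum g = SemiringSum.sum-cong-≋ f≈g

  ∑-distrib-+ : ∀ {n} (f g : Fin n → Carrier) → ∑ F (λ i → f i + g i) ≈ ∑ F f + ∑ F g
  ∑-distrib-+ f g rewrite ∑≡sum (λ i → f i + g i) | ∑≡sum f | ∑≡sum g = SemiringSum.∑-distrib-+ f g

  *-distribˡ-∑ : ∀ {n} x (f : Fin n → Carrier) → x * ∑ F f ≈ ∑ F (λ i → x * f i)
  *-distribˡ-∑ x f rewrite ∑≡sum f | ∑≡sum (λ i → x * f i) = SemiringSum.*-distribˡ-sum x f

  *-distribʳ-∑ : ∀ {n} x (f : Fin n → Carrier) → ∑ F f * x ≈ ∑ F (λ i → f i * x)
  *-distribʳ-∑ x f rewrite ∑≡sum f | ∑≡sum (λ i → f i * x) = SemiringSum.*-distribʳ-sum x f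

  ∑-comm : ∀ {m n} (f : Fin m → Fin n → Carrier) →
    ∑ F (λ i → ∑ F (λ j → f i j)) ≈ ∑ F (λ j → ∑ F (λ i → f i j))
  ∑-comm f = begin
    ∑ F (λ i → ∑ F (f i))              ≡⟨ ∑≡sum₂ f ⟩
    sum (λ i → sum (f i))              ≈⟨ SemiringSum.∑-comm f ⟩
    sum (λ j → sum (λ i → f i j))      ≡⟨ ∑≡sum₂ (λ j i → f i j) ⟨
    ∑ F (λ j → ∑ F (λ i → f i j))      ∎
    where
    open ≈-Reasoning setoid
    ∑≡sum₂ : ∀ {m n} (g : Fin m → Fin n → Carrier) → ∑ F (λ i → ∑ F (g i)) ≡ sum (λ i → sum (g i))
    ∑≡sum₂ g = ≡.trans (∑≡sum (λ i → ∑ F (g i))) (SemiringSum.sum-cong-≗ (λ i → ∑≡sum (g i)))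

  ∑-*-∑-assoc : ∀ {m n} (a : Fin m → Carrier) (M : Fin m → Fin n → Carrier) (g : Fin n → Carrier) →
    ∑ F (λ j → a j * ∑ F (λ k → M j k * g k)) ≈ ∑ F (λ k → ∑ F (λ j → a j * M j k) * g k)
  ∑-*-∑-assoc a M g = begin
    ∑ F (λ j → a j * ∑ F (λ k → M j k * g k))   ≈⟨ ∑-cong (λ j → *-distribˡ-∑ (a j) (λ k → M j k * g k)) ⟩
    ∑ F (λ j → ∑ F (λ k → a j * (M j k * g k))) ≈⟨ ∑-cong (λ j → ∑-cong (λ k → sym (*-assoc (a j) (M j k) (g k)))) ⟩
    ∑ F (λ j → ∑ F (λ k → a j * M j k * g k))   ≈⟨ ∑-comm (λ j k → a j * M j k * g k) ⟩
    ∑ F (λ k → ∑ F (λ j → a j * M j k * g k))   ≈⟨ ∑-cong (λ k → sym (*-distribʳ-∑ (g k) (λ j → a j * M j k))) ⟩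
    ∑ F (λ k → ∑ F (λ j → a j * M j k) * g k)   ∎
    where open ≈-Reasoning setoid

  ∑-zero : ∀ {n} {f : Fin n → Carrier} → (∀ i → f i ≈ 0#) → ∑ F f ≈ 0#
  ∑-zero {zero}  f≈0 = refl
  ∑-zero {suc n} f≈0 = trans (+-cong (f≈0 zero) (∑-zero (f≈0 ∘ suc))) (+-identityʳ 0#)

  ∑-mono-≤ : ∀ {n} {f g : Fin n → Carrier} → (∀ i → f i ≤ g i) → ∑ F f ≤ ∑ F g
  ∑-mono-≤ {zero}  f≤g = ≤-refl
  ∑-mono-≤ {suc n} f≤g = +-mono-≤ (f≤g zero) (∑-mono-≤ (f≤g ∘ suc))

  ∑-nonneg : ∀ {n} {f : Fin n → Carrier} → (∀ i → 0# ≤ f i) → 0# ≤ ∑ F f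
  ∑-nonneg {zero}  0≤f = ≤-refl
  ∑-nonneg {suc n} 0≤f = 0≤x+y (0≤f zero) (∑-nonneg (0≤f ∘ suc))

  term≤∑ : ∀ {n} {f : Fin n → Carrier} → (∀ i → 0# ≤ f i) → ∀ k → f k ≤ ∑ F f
  term≤∑ {suc n} {f} 0≤f zero =
    ≤-respˡ-≈ (+-identityʳ (f zero)) (+-monoʳ-≤ (f zero) (∑-nonneg (0≤f ∘ suc)))
  term≤∑ {suc n} {f} 0≤f (suc k) =
    ≤-respˡ-≈ (+-identityˡ (f (suc k))) (+-mono-≤ (0≤f zero) (term≤∑ (0≤f ∘ suc) k))

  ∑-subsingleton : ∀ {n} (i : Fin n) → (∀ j → i ≡ j) → (f : Fin n → Carrier) → ∑ F f ≈ f i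
  ∑-subsingleton {suc zero}    zero      i≡ f = +-identityʳ (f zero)
  ∑-subsingleton {suc (suc n)} i         i≡ f with ≡.trans (≡.sym (i≡ zero)) (i≡ (suc zero))
  ... | ()

  idMat-suc : ∀ {n} (j i : Fin n) → idMat F (suc j) (suc i) ≈ idMat F j i
  idMat-suc j i with j ≟ i
  ... | yes _ = refl
  ... | no  _ = refl

  idMat-nonneg : ∀ {n} (j i : Fin n) → 0# ≤ idMat F j i
  idMat-nonneg zero    zero    = 0≤1
  idMat-nonneg zero    (suc i) = ≤-refl
  idMat-nonneg (suc j) zero    = ≤-refl
  idMat-nonneg (suc j) (suc i) = ≤-respʳ-≈ (sym (idMat-suc j i)) (idMat-nonneg j i)

  ∑-*-idMat : ∀ {n} (g : Fin n → Carrier) i → ∑ F (λ k → g k * idMat F k i) ≈ g i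
  ∑-*-idMat g zero =
    trans (+-cong (*-identityʳ (g zero)) (∑-zero (λ k → zeroʳ (g (suc k))))) (+-identityʳ (g zero))
  ∑-*-idMat g (suc i) =
    trans (+-cong (zeroʳ (g zero)) (trans (∑-cong (λ k → *-congˡ (idMat-suc k i))) (∑-*-idMat (g ∘ suc) i)))
          (+-identityˡ (g (suc i)))

  ∑-idMat-* : ∀ {n} (g : Fin n → Carrier) j → ∑ F (λ k → idMat F j k * g k) ≈ g j
  ∑-idMat-* g zero =
    trans (+-cong (*-identityˡ (g zero)) (∑-zero (λ k → zeroˡ (g (suc k))))) (+-identityʳ (g zero))
  ∑-idMat-* g (suc j) =
    trans (+-cong (zeroˡ (g zero)) (trans (∑-cong (λ k → *-congʳ (idMat-suc j k))) (∑-idMat-* (g ∘ suc) j)))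
          (+-identityˡ (g (suc j)))

module Indicators {c ℓ₁ ℓ₂} (F : OrderedField c ℓ₁ ℓ₂) where
  open OrderedField F hiding (zero; _≤_)
  open OrderedFieldProperties F
  open Summation F

  χ : ∀ {n} → Subset n → Fin n → Carrier
  χ S i = if lookup S i then 1# else 0#

  χ-nonneg : ∀ {n} (S : Subset n) i → 0# ≤ χ S i
  χ-nonneg S i with lookup S i
  ... | true  = 0≤1
  ... | false = ≤-refl

  χ-∈ : ∀ {n} (S : Subset n) i → lookup S i ≡ true → χ S i ≈ 1#
  χ-∈ S i i∈S rewrite i∈S = refl

  χ-∉ : ∀ {n} (S : Subset n) i → lookup S i ≡ false → χ S i ≈ 0#
  χ-∉ S i i∉S rewrite i∉S = refl

  χ+χ∁≈1 : ∀ {n} (S : Subset n) i → χ S i + χ (∁ S) i ≈ 1#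
  χ+χ∁≈1 S i rewrite lookup-map i not S with lookup S i
  ... | true  = +-identityʳ 1#
  ... | false = +-identityˡ 1#

  indic≈χ* : ∀ {n} (S : Subset n) i x → indic F S i x ≈ χ S i * x
  indic≈χ* S i x with lookup S i
  ... | true  = sym (*-identityˡ x)
  ... | false = sym (zeroˡ x)

  χ*x+χ∁*x≈x : ∀ {n} (S : Subset n) i x → χ S i * x + χ (∁ S) i * x ≈ x
  χ*x+χ∁*x≈x S i x = trans (sym (distribʳ x (χ S i) (χ (∁ S) i))) (trans (*-congʳ (χ+χ∁≈1 S i)) (*-identityˡ x))

  ∑-χ+∑-χ∁ : ∀ {n} (S : Subset n) (f : Fin n → Carrier) →
    ∑ F (λ i → χ S i * f i) + ∑ F (λ i → χ (∁ S) i * f i) ≈ ∑ F f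
  ∑-χ+∑-χ∁ S f = trans (sym (∑-distrib-+ (λ i → χ S i * f i) (λ i → χ (∁ S) i * f i)))
                        (∑-cong (λ i → χ*x+χ∁*x≈x S i (f i)))

module RandomWalk {c ℓ₁ ℓ₂} (F : OrderedField c ℓ₁ ℓ₂) {n : ℕ} (A : Mat F n)
  (U : OrderedField.Carrier F) (weights : WeightsIn1U F A U) (connected : StronglyConnected F A)
  (π : Fin n → OrderedField.Carrier F) (stationary : Stationary F A π) where

  open OrderedField F hiding (zero; _≤_)
  open OrderedFieldProperties F
  open Summation F
  open Indicators F
  open import Algebra.Solver.Ring.NaturalCoefficients.Default commutativeSemiring

  d : Fin n → Carrier
  d = outDeg F A

  W : Mat F n
  W = walkMat F A

  P : ℕ → Mat F n
  P = matPow F W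

  W-fixes-π : ∀ j → ∑ F (λ i → W j i * π i) ≈ π j
  W-fixes-π = proj₁ stationary

  π-nonneg : ∀ v → 0# ≤ π v
  π-nonneg = proj₁ (proj₂ stationary)

  ∑π≈1 : ∑ F π ≈ 1#
  ∑π≈1 = proj₂ (proj₂ stationary)

  A-nonneg : ∀ j i → 0# ≤ A j i
  A-nonneg j i with weights i j
  ... | inj₁ A≈0       = ≤-reflexive (sym A≈0)
  ... | inj₂ (1≤A , _) = ≤-trans 0≤1 1≤A

  A≤U : 1# ≤ U → ∀ j i → A j i ≤ U
  A≤U 1≤U j i with weights i j
  ... | inj₁ A≈0       = ≤-trans (≤-reflexive A≈0) (≤-trans 0≤1 1≤U)
  ... | inj₂ (_ , A≤U) = A≤U

  -- A vertex without out-edges would, by strong connectivity, be the only vertex;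
  -- stationarity would then force its mass to be W i i * π i = 0.
  1≤d : ∀ i → 1# ≤ d i
  1≤d i with ∃-or-∀ (λ j → edge-or-none j)
    where
    edge-or-none : ∀ j → 1# ≤ A j i ⊎ A j i ≈ 0#
    edge-or-none j with weights i j
    ... | inj₁ A≈0       = inj₂ A≈0
    ... | inj₂ (1≤A , _) = inj₁ 1≤A
  ... | inj₁ (j , 1≤A) = ≤-trans 1≤A (term≤∑ (λ k → A-nonneg k i) j)
  ... | inj₂ no-edge   = ⊥-elim (0≉1 (trans (sym πi≈0) πi≈1))
    where
    only-i : ∀ j → i ≡ j
    only-i j with connected i j
    ... | ε           = ≡.refl
    ... | edge ◅ _    = ⊥-elim (edge (no-edge _))
    πi≈0 : π i ≈ 0#
    πi≈0 = begin
      π i                          ≈⟨ W-fixes-π i ⟨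
      ∑ F (λ k → W i k * π k)      ≈⟨ ∑-subsingleton i only-i (λ k → W i k * π k) ⟩
      A i i * d i ⁻¹ * π i         ≈⟨ *-congʳ (*-congʳ (no-edge i)) ⟩
      0# * d i ⁻¹ * π i            ≈⟨ trans (*-congʳ (zeroˡ (d i ⁻¹))) (zeroˡ (π i)) ⟩
      0#                           ∎
      where open ≈-Reasoning setoid
    πi≈1 : π i ≈ 1#
    πi≈1 = trans (sym (∑-subsingleton i only-i π)) ∑π≈1

  d⁻¹-nonneg : ∀ i → 0# ≤ d i ⁻¹
  d⁻¹-nonneg i = 1≤x⇒0≤x⁻¹ (1≤d i)

  W-nonneg : ∀ j i → 0# ≤ W j i
  W-nonneg j i = *-nonneg (A-nonneg j i) (d⁻¹-nonneg i)

  ∑-W : ∀ i → ∑ F (λ j → W j i) ≈ 1#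
  ∑-W i = trans (sym (*-distribʳ-∑ (d i ⁻¹) (λ j → A j i))) (⁻¹-inverse (d i) (1≤x⇒x≉0 (1≤d i)))

  P-nonneg : ∀ ℓ j i → 0# ≤ P ℓ j i
  P-nonneg zero    j i = idMat-nonneg j i
  P-nonneg (suc ℓ) j i = ∑-nonneg (λ k → *-nonneg (W-nonneg j k) (P-nonneg ℓ k i))

  ∑-P : ∀ ℓ i → ∑ F (λ j → P ℓ j i) ≈ 1#
  ∑-P zero    i = trans (∑-cong (λ j → sym (*-identityˡ (idMat F j i)))) (∑-*-idMat (λ _ → 1#) i)
  ∑-P (suc ℓ) i = begin
    ∑ F (λ j → ∑ F (λ k → W j k * P ℓ k i))   ≈⟨ ∑-comm (λ j k → W j k * P ℓ k i) ⟩
    ∑ F (λ k → ∑ F (λ j → W j k * P ℓ k i))   ≈⟨ ∑-cong (λ k → sym (*-distribʳ-∑ (P ℓ k i) (λ j → W j k))) ⟩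
    ∑ F (λ k → ∑ F (λ j → W j k) * P ℓ k i)   ≈⟨ ∑-cong (λ k → trans (*-congʳ (∑-W k)) (*-identityˡ (P ℓ k i))) ⟩
    ∑ F (λ k → P ℓ k i)                       ≈⟨ ∑-P ℓ i ⟩
    1#                                        ∎
    where open ≈-Reasoning setoid

  P-fixes-π : ∀ ℓ j → ∑ F (λ i → P ℓ j i * π i) ≈ π j
  P-fixes-π zero    j = ∑-idMat-* π j
  P-fixes-π (suc ℓ) j = begin
    ∑ F (λ i → ∑ F (λ k → W j k * P ℓ k i) * π i)   ≈⟨ ∑-*-∑-assoc (W j) (P ℓ) π ⟨
    ∑ F (λ k → W j k * ∑ F (λ i → P ℓ k i * π i))   ≈⟨ ∑-cong (λ k → *-congˡ (P-fixes-π ℓ k)) ⟩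
    ∑ F (λ k → W j k * π k)                         ≈⟨ W-fixes-π j ⟩
    π j                                             ∎
    where open ≈-Reasoning setoid

  π↾ : Subset n → Fin n → Carrier
  π↾ S i = χ S i * π i

  mass : ℕ → Subset n → Fin n → Carrier
  mass ℓ S k = ∑ F (λ i → P ℓ k i * π↾ S i)

  into : Subset n → Fin n → Carrier
  into T k = ∑ F (λ j → χ T j * W j k)

  π↾-nonneg : ∀ S i → 0# ≤ π↾ S i
  π↾-nonneg S i = *-nonneg (χ-nonneg S i) (π-nonneg i)

  mass-nonneg : ∀ ℓ S k → 0# ≤ mass ℓ S k
  mass-nonneg ℓ S k = ∑-nonneg (λ i → *-nonneg (P-nonneg ℓ k i) (π↾-nonneg S i))

  into-nonneg : ∀ T k → 0# ≤ into T k
  into-nonneg T k = ∑-nonneg (λ j → *-nonneg (χ-nonneg T j) (W-nonneg j k))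

  vol≈∑π↾ : ∀ S → vol F π S ≈ ∑ F (π↾ S)
  vol≈∑π↾ S = ∑-cong (λ v → indic≈χ* S v (π v))

  cut≈∑χ*mass : ∀ ℓ S T → cutPow F A π ℓ S T ≈ ∑ F (λ j → χ T j * mass ℓ S j)
  cut≈∑χ*mass ℓ S T = begin
    cutPow F A π ℓ S T                       ≈⟨ ∑-cong (λ i → ∑-cong (λ j → indicators i j)) ⟩
    ∑ F (λ i → ∑ F (λ j → χ T j * t j i))    ≈⟨ ∑-comm (λ i j → χ T j * t j i) ⟩
    ∑ F (λ j → ∑ F (λ i → χ T j * t j i))    ≈⟨ ∑-cong (λ j → *-distribˡ-∑ (χ T j) (t j)) ⟨
    ∑ F (λ j → χ T j * mass ℓ S j)           ∎
    where
    open ≈-Reasoning setoid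
    t : Fin n → Fin n → Carrier
    t j i = P ℓ j i * π↾ S i
    indicators : ∀ i j → indic F S i (indic F T j (π i * P ℓ j i)) ≈ χ T j * t j i
    indicators i j = begin
      indic F S i (indic F T j (π i * P ℓ j i))   ≈⟨ indic≈χ* S i _ ⟩
      χ S i * indic F T j (π i * P ℓ j i)         ≈⟨ *-congˡ (indic≈χ* T j _) ⟩
      χ S i * (χ T j * (π i * P ℓ j i))           ≈⟨ solve 4 (λ s t p q → s :* (t :* (p :* q)) := t :* (q :* (s :* p)))
                                                           refl (χ S i) (χ T j) (π i) (P ℓ j i) ⟩
      χ T j * t j i                               ∎

  cut-suc : ∀ ℓ S T → cutPow F A π (suc ℓ) S T ≈ ∑ F (λ k → into T k * mass ℓ S k)
  cut-suc ℓ S T = begin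
    cutPow F A π (suc ℓ) S T                             ≈⟨ cut≈∑χ*mass (suc ℓ) S T ⟩
    ∑ F (λ j → χ T j * mass (suc ℓ) S j)                 ≈⟨ ∑-cong (λ j → *-congˡ (mass-suc j)) ⟨
    ∑ F (λ j → χ T j * ∑ F (λ k → W j k * mass ℓ S k))   ≈⟨ ∑-*-∑-assoc (χ T) W (mass ℓ S) ⟩
    ∑ F (λ k → into T k * mass ℓ S k)                    ∎
    where
    open ≈-Reasoning setoid
    mass-suc : ∀ j → ∑ F (λ k → W j k * mass ℓ S k) ≈ mass (suc ℓ) S j
    mass-suc j = ∑-*-∑-assoc (W j) (P ℓ) (π↾ S)

  mass+mass∁≈π : ∀ ℓ S k → mass ℓ S k + mass ℓ (∁ S) k ≈ π k
  mass+mass∁≈π ℓ S k = begin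
    mass ℓ S k + mass ℓ (∁ S) k                        ≈⟨ ∑-distrib-+ (λ i → P ℓ k i * π↾ S i) (λ i → P ℓ k i * π↾ (∁ S) i) ⟨
    ∑ F (λ i → P ℓ k i * π↾ S i + P ℓ k i * π↾ (∁ S) i) ≈⟨ ∑-cong (λ i → trans (sym (distribˡ (P ℓ k i) _ _)) (*-congˡ (split i))) ⟩
    ∑ F (λ i → P ℓ k i * π i)                          ≈⟨ P-fixes-π ℓ k ⟩
    π k                                                ∎
    where
    open ≈-Reasoning setoid
    split : ∀ i → π↾ S i + π↾ (∁ S) i ≈ π i
    split i = χ*x+χ∁*x≈x S i (π i)

  into+into∁≈1 : ∀ T k → into T k + into (∁ T) k ≈ 1#
  into+into∁≈1 T k = trans (∑-χ+∑-χ∁ T (λ j → W j k)) (∑-W k)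

  ∑-mass : ∀ ℓ S → ∑ F (mass ℓ S) ≈ vol F π S
  ∑-mass ℓ S = begin
    ∑ F (λ k → ∑ F (λ i → P ℓ k i * π↾ S i))   ≈⟨ ∑-comm (λ k i → P ℓ k i * π↾ S i) ⟩
    ∑ F (λ i → ∑ F (λ k → P ℓ k i * π↾ S i))   ≈⟨ ∑-cong (λ i → *-distribʳ-∑ (π↾ S i) (λ k → P ℓ k i)) ⟨
    ∑ F (λ i → ∑ F (λ k → P ℓ k i) * π↾ S i)   ≈⟨ ∑-cong (λ i → trans (*-congʳ (∑-P ℓ i)) (*-identityˡ (π↾ S i))) ⟩
    ∑ F (π↾ S)                                 ≈⟨ vol≈∑π↾ S ⟨
    vol F π S                                  ∎
    where open ≈-Reasoning setoid

  ∑-into*π : ∀ T → ∑ F (λ k → into T k * π k) ≈ vol F π T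
  ∑-into*π T = begin
    ∑ F (λ k → into T k * π k)                  ≈⟨ ∑-*-∑-assoc (χ T) W π ⟨
    ∑ F (λ j → χ T j * ∑ F (λ k → W j k * π k)) ≈⟨ ∑-cong (λ j → *-congˡ (W-fixes-π j)) ⟩
    ∑ F (π↾ T)                                  ≈⟨ vol≈∑π↾ T ⟨
    vol F π T                                   ∎
    where open ≈-Reasoning setoid

  cut-inclusion-exclusion : ∀ ℓ S T →
    1# + cutPow F A π ℓ S T ≈ vol F π S + vol F π T + cutPow F A π ℓ (∁ S) (∁ T)
  cut-inclusion-exclusion ℓ S T = begin
    1# + cutPow F A π ℓ S T                        ≈⟨ +-cong (sym ∑[p+q][e+f]≈1) (cut≈∑χ*mass ℓ S T) ⟩
    ∑ F (λ k → (p k + q k) * (e k + f k)) + ∑ F (λ k → e k * p k)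
                                                   ≈⟨ ∑-distrib-+ (λ k → (p k + q k) * (e k + f k)) (λ k → e k * p k) ⟨
    ∑ F (λ k → (p k + q k) * (e k + f k) + e k * p k)
                                                   ≈⟨ ∑-cong (λ k → regroup (p k) (q k) (e k) (f k)) ⟩
    ∑ F (λ k → p k * (e k + f k) + e k * (p k + q k) + f k * q k)
                                                   ≈⟨ ∑-distrib-+ (λ k → p k * (e k + f k) + e k * (p k + q k)) (λ k → f k * q k) ⟩
    ∑ F (λ k → p k * (e k + f k) + e k * (p k + q k)) + ∑ F (λ k → f k * q k)
                                                   ≈⟨ +-congʳ (∑-distrib-+ (λ k → p k * (e k + f k)) (λ k → e k * (p k + q k))) ⟩
    ∑ F (λ k → p k * (e k + f k)) + ∑ F (λ k → e k * (p k + q k)) + ∑ F (λ k → f k * q k)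
                                                   ≈⟨ +-cong (+-cong ∑p[e+f]≈volS ∑e[p+q]≈volT) (sym (cut≈∑χ*mass ℓ (∁ S) (∁ T))) ⟩
    vol F π S + vol F π T + cutPow F A π ℓ (∁ S) (∁ T)  ∎
    where
    open ≈-Reasoning setoid
    p q e f : Fin n → Carrier
    p = mass ℓ S
    q = mass ℓ (∁ S)
    e = χ T
    f = χ (∁ T)
    regroup : ∀ p q e f → (p + q) * (e + f) + e * p ≈ p * (e + f) + e * (p + q) + f * q
    regroup = solve 4 (λ p q e f → (p :+ q) :* (e :+ f) :+ e :* p := p :* (e :+ f) :+ e :* (p :+ q) :+ f :* q) refl
    ∑[p+q][e+f]≈1 : ∑ F (λ k → (p k + q k) * (e k + f k)) ≈ 1#
    ∑[p+q][e+f]≈1 = trans (∑-cong (λ k → trans (*-cong (mass+mass∁≈π ℓ S k) (χ+χ∁≈1 T k)) (*-identityʳ (π k)))) ∑π≈1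
    ∑p[e+f]≈volS : ∑ F (λ k → p k * (e k + f k)) ≈ vol F π S
    ∑p[e+f]≈volS = trans (∑-cong (λ k → trans (*-congˡ (χ+χ∁≈1 T k)) (*-identityʳ (p k)))) (∑-mass ℓ S)
    ∑e[p+q]≈volT : ∑ F (λ k → e k * (p k + q k)) ≈ vol F π T
    ∑e[p+q]≈volT = trans (∑-cong (λ k → *-congˡ (mass+mass∁≈π ℓ S k))) (sym (vol≈∑π↾ T))

  cut∁≤cut : ∀ ℓ S T → 1# ≤ vol F π S + vol F π T → cutPow F A π ℓ (∁ S) (∁ T) ≤ cutPow F A π ℓ S T
  cut∁≤cut ℓ S T 1≤vol = +-cancelʳ-≤ 1#
    (≤-resp-≈ (+-comm 1# _) (trans (sym (cut-inclusion-exclusion ℓ S T)) (+-comm 1# _))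
              (+-monoˡ-≤ (cutPow F A π ℓ (∁ S) (∁ T)) 1≤vol))

  Enters : Subset n → Fin n → Fin n → Set ℓ₂
  Enters T k j = lookup T j ≡ true × 1# ≤ A j k

  Misses : Subset n → Fin n → Fin n → Set ℓ₁
  Misses T k j = lookup T j ≡ false ⊎ A j k ≈ 0#

  enters-or-misses : ∀ T k j → Enters T k j ⊎ Misses T k j
  enters-or-misses T k j with lookup T j | weights k j
  ... | false | _              = inj₂ (inj₁ ≡.refl)
  ... | true  | inj₁ A≈0       = inj₂ (inj₂ A≈0)
  ... | true  | inj₂ (1≤A , _) = inj₁ (≡.refl , 1≤A)

  enters⇒¬misses : ∀ T {k j} → Enters T k j → ¬ Misses T k j
  enters⇒¬misses T (j∈T , _)   (inj₁ j∉T) with ≡.trans (≡.sym j∈T) j∉T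
  ... | ()
  enters⇒¬misses T (_ , 1≤A) (inj₂ A≈0) = 1≤x⇒x≉0 1≤A A≈0

  into-misses : ∀ T k → (∀ j → Misses T k j) → into T k ≈ 0#
  into-misses T k misses = ∑-zero vanish
    where
    vanish : ∀ j → χ T j * W j k ≈ 0#
    vanish j with misses j
    ... | inj₁ j∉T = trans (*-congʳ (χ-∉ T j j∉T)) (zeroˡ (W j k))
    ... | inj₂ A≈0 = trans (*-congˡ (trans (*-congʳ A≈0) (zeroˡ (d k ⁻¹)))) (zeroʳ (χ T j))

  d⁻¹≤into : ∀ T {k j} → Enters T k j → d k ⁻¹ ≤ into T k
  d⁻¹≤into T {k} {j} (j∈T , 1≤A) = begin
    d k ⁻¹                ≈⟨ *-identityˡ (d k ⁻¹) ⟨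
    1# * d k ⁻¹           ≤⟨ *-monoʳ-≤ (d⁻¹-nonneg k) 1≤A ⟩
    A j k * d k ⁻¹        ≈⟨ trans (*-congʳ (χ-∈ T j j∈T)) (*-identityˡ (W j k)) ⟨
    χ T j * W j k         ≤⟨ term≤∑ (λ j → *-nonneg (χ-nonneg T j) (W-nonneg j k)) j ⟩
    into T k              ∎
    where open ≤-Reasoning

  entersSome : ∀ T k → Σ (Fin n) (Enters T k) ⊎ (∀ j → Misses T k j)
  entersSome T k = ∃-or-∀ (enters-or-misses T k)

  predecessors : Subset n → Subset n
  predecessors T = tabulate (λ k → [ (λ _ → true) , (λ _ → false) ]′ (entersSome T k))

  Mixed : Subset n → Fin n → Set ℓ₂
  Mixed T k = Σ (Fin n) (Enters T k) × Σ (Fin n) (Enters (∁ T) k)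

  Unmixed : Subset n → Fin n → Set ℓ₁
  Unmixed T k = (∀ j → Misses T k j) ⊎ (∀ j → Misses (∁ T) k j)

  mixed-or-unmixed : ∀ T k → Mixed T k ⊎ Unmixed T k
  mixed-or-unmixed T k with entersSome T k | entersSome (∁ T) k
  ... | inj₁ enters | inj₁ enters∁ = inj₁ (enters , enters∁)
  ... | inj₂ misses | _            = inj₂ (inj₁ misses)
  ... | inj₁ _      | inj₂ misses∁ = inj₂ (inj₂ misses∁)

  into-unmixed : ∀ T k → Unmixed T k → into T k ≈ χ (predecessors T) k
  into-unmixed T k unmixed
    rewrite lookup∘tabulate (λ k → [ (λ _ → true) , (λ _ → false) ]′ (entersSome T k)) k
    with entersSome T k | unmixed
  ... | inj₂ misses  | _            = into-misses T k misses
  ... | inj₁ (j , e) | inj₁ misses  = ⊥-elim (enters⇒¬misses T e (misses j))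
  ... | inj₁ _       | inj₂ misses∁ =
    trans (sym (+-identityʳ (into T k))) (trans (+-congˡ (sym (into-misses (∁ T) k misses∁))) (into+into∁≈1 T k))

  cut-suc-unmixed : ∀ ℓ S T → (∀ k → Unmixed T k) →
    cutPow F A π (suc ℓ) S T ≈ cutPow F A π ℓ S (predecessors T)
  cut-suc-unmixed ℓ S T unmixed =
    trans (cut-suc ℓ S T) (trans (∑-cong (λ k → *-congʳ (into-unmixed T k (unmixed k))))
                                 (sym (cut≈∑χ*mass ℓ S (predecessors T))))

  vol-predecessors : ∀ T → (∀ k → Unmixed T k) → vol F π (predecessors T) ≈ vol F π T
  vol-predecessors T unmixed =
    trans (vol≈∑π↾ (predecessors T)) (trans (∑-cong (λ k → *-congʳ (sym (into-unmixed T k (unmixed k)))))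
                                            (∑-into*π T))

  d⁻¹*mass≤cut-suc : ∀ ℓ S T {k j} → Enters T k j → d k ⁻¹ * mass ℓ S k ≤ cutPow F A π (suc ℓ) S T
  d⁻¹*mass≤cut-suc ℓ S T {k} enters = begin
    d k ⁻¹ * mass ℓ S k                  ≤⟨ *-monoʳ-≤ (mass-nonneg ℓ S k) (d⁻¹≤into T enters) ⟩
    into T k * mass ℓ S k                ≤⟨ term≤∑ (λ k → *-nonneg (into-nonneg T k) (mass-nonneg ℓ S k)) k ⟩
    ∑ F (λ k → into T k * mass ℓ S k)    ≈⟨ cut-suc ℓ S T ⟨
    cutPow F A π (suc ℓ) S T             ∎
    where open ≤-Reasoning

  d⁻¹*π≤2cut-suc : ∀ ℓ S T {k} → 1# ≤ vol F π S + vol F π T → Mixed T k →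
    d k ⁻¹ * π k ≤ cutPow F A π (suc ℓ) S T + cutPow F A π (suc ℓ) S T
  d⁻¹*π≤2cut-suc ℓ S T {k} 1≤vol ((_ , enters) , (_ , enters∁)) = begin
    d k ⁻¹ * π k                                                ≈⟨ *-congˡ (mass+mass∁≈π ℓ S k) ⟨
    d k ⁻¹ * (mass ℓ S k + mass ℓ (∁ S) k)                      ≈⟨ distribˡ (d k ⁻¹) (mass ℓ S k) (mass ℓ (∁ S) k) ⟩
    d k ⁻¹ * mass ℓ S k + d k ⁻¹ * mass ℓ (∁ S) k               ≤⟨ +-mono-≤ (d⁻¹*mass≤cut-suc ℓ S T enters)
                                                                             (d⁻¹*mass≤cut-suc ℓ (∁ S) (∁ T) enters∁) ⟩
    cutPow F A π (suc ℓ) S T + cutPow F A π (suc ℓ) (∁ S) (∁ T)  ≤⟨ +-monoʳ-≤ _ (cut∁≤cut (suc ℓ) S T 1≤vol) ⟩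
    cutPow F A π (suc ℓ) S T + cutPow F A π (suc ℓ) S T          ∎
    where open ≤-Reasoning

  cut₀≈∑χ*π↾ : ∀ S T → cutPow F A π 0 S T ≈ ∑ F (λ k → χ T k * π↾ S k)
  cut₀≈∑χ*π↾ S T = trans (cut≈∑χ*mass 0 S T) (∑-cong (λ k → *-congˡ (∑-idMat-* (π↾ S) k)))

  cut-zero-or-π : ∀ S T → cutPow F A π 0 S T ≈ 0# ⊎ Σ (Fin n) (λ k → π k ≤ cutPow F A π 0 S T)
  cut-zero-or-π S T with ∃-or-∀ term-cases
    where
    term-cases : ∀ k → χ T k * π↾ S k ≈ π k ⊎ χ T k * π↾ S k ≈ 0#
    term-cases k with lookup T k | lookup S k
    ... | false | _     = inj₂ (zeroˡ _)
    ... | true  | false = inj₂ (trans (*-identityˡ (0# * π k)) (zeroˡ (π k)))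
    ... | true  | true  = inj₁ (trans (*-identityˡ (1# * π k)) (*-identityˡ (π k)))
  ... | inj₁ (k , term≈π) = inj₂ (k , ≤-resp-≈ term≈π (sym (cut₀≈∑χ*π↾ S T))
                                         (term≤∑ (λ k → *-nonneg (χ-nonneg T k) (π↾-nonneg S k)) k))
  ... | inj₂ terms≈0      = inj₁ (trans (cut₀≈∑χ*π↾ S T) (∑-zero terms≈0))

  m*d≤U : 1# ≤ U → ∀ {m} → 0# ≤ m → (∀ v → m ≤ π v) → ∀ k → m * d k ≤ U
  m*d≤U 1≤U {m} 0≤m m≤π k = begin
    m * d k                      ≈⟨ *-distribˡ-∑ m (λ j → A j k) ⟩
    ∑ F (λ j → m * A j k)        ≤⟨ ∑-mono-≤ (λ j → *-mono-≤ 0≤m (m≤π j) (A-nonneg j k) (A≤U 1≤U j k)) ⟩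
    ∑ F (λ j → π j * U)          ≈⟨ *-distribʳ-∑ U π ⟨
    ∑ F π * U                    ≈⟨ trans (*-congʳ ∑π≈1) (*-identityˡ U) ⟩
    U                            ∎
    where open ≤-Reasoning

  module _ (κ : Carrier) (κ≤π : ∀ k → κ ≤ π k) (κ+κ≤d⁻¹*π : ∀ k → κ + κ ≤ d k ⁻¹ * π k) where

    cut-zero-or-≥ : ∀ ℓ S T → 1# ≤ vol F π S + vol F π T →
      cutPow F A π ℓ S T ≈ 0# ⊎ κ ≤ cutPow F A π ℓ S T
    cut-zero-or-≥ zero S T _ with cut-zero-or-π S T
    ... | inj₁ cut≈0       = inj₁ cut≈0
    ... | inj₂ (k , π≤cut) = inj₂ (≤-trans (κ≤π k) π≤cut)
    cut-zero-or-≥ (suc ℓ) S T 1≤vol with ∃-or-∀ (mixed-or-unmixed T)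
    ... | inj₁ (k , mixed) =
      inj₂ (x+x≤y+y⇒x≤y (≤-trans (κ+κ≤d⁻¹*π k) (d⁻¹*π≤2cut-suc ℓ S T 1≤vol mixed)))
    ... | inj₂ unmixed =
      Sum.map (trans cut≈) (≤-respʳ-≈ (sym cut≈)) (cut-zero-or-≥ ℓ S (predecessors T) 1≤vol′)
      where
      cut≈ : cutPow F A π (suc ℓ) S T ≈ cutPow F A π ℓ S (predecessors T)
      cut≈ = cut-suc-unmixed ℓ S T unmixed
      1≤vol′ : 1# ≤ vol F π S + vol F π (predecessors T)
      1≤vol′ = ≤-respʳ-≈ (+-congˡ (sym (vol-predecessors T unmixed))) 1≤vol

mainTheorem11 : ∀ {c ℓ₁ ℓ₂} (F : OrderedField c ℓ₁ ℓ₂) →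
    let open OrderedField F in
    (n : ℕ) (A : Mat F n) (U : Carrier) →
    1# ≤ U →
    WeightsIn1U F A U →
    StronglyConnected F A →
    (π : Fin n → Carrier) → Stationary F A π →
    (πmin : Carrier) → IsMin F π πmin →
    (ℓ : ℕ) (S T : Subset n) →
    1# ≤ (vol F π S + vol F π T) →
    (cutPow F A π ℓ S T ≈ 0#)
      ⊎ (cube F (πmin * (((1# + 1#) * U) ⁻¹)) ≤ cutPow F A π ℓ S T)
mainTheorem11 F n A U 1≤U weights connected π stationary πmin ((v , πv≈πmin) , πmin≤π) ℓ S T 1≤vol =
  cut-zero-or-≥ β (λ k → ≤-trans β≤πmin (πmin≤π k)) β+β≤d⁻¹*π ℓ S T 1≤vol
  where
  open OrderedField F hiding (_≤_)
  open OrderedFieldProperties F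
  open Summation F
  open RandomWalk F A U weights connected π stationary

  β : Carrier
  β = cube F (πmin * (((1# + 1#) * U) ⁻¹))

  0≤πmin : 0# ≤ πmin
  0≤πmin = ≤-respʳ-≈ πv≈πmin (π-nonneg v)

  πmin≤1 : πmin ≤ 1#
  πmin≤1 = ≤-resp-≈ πv≈πmin ∑π≈1 (term≤∑ π-nonneg v)

  β≤πmin : β ≤ πmin
  β≤πmin = cube≤ 0≤πmin πmin≤1 1≤U

  β+β≤d⁻¹*π : ∀ k → β + β ≤ d k ⁻¹ * π k
  β+β≤d⁻¹*π k = ≤-trans (x*y≤z⇒x≤y⁻¹*z (1≤d k) [β+β]*d≤πmin) (*-monoˡ-≤ (d⁻¹-nonneg k) (πmin≤π k))
    where
    [β+β]*d≤πmin : (β + β) * d k ≤ πmin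
    [β+β]*d≤πmin = [cube+cube]*D≤ 0≤πmin πmin≤1 1≤U (m*d≤U 1≤U 0≤πmin πmin≤π k)
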